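{- Let $C\ge1$ be an integer and let $G$ be a simple graph with at least one vertex such that $\rho(G)<C+\tfrac12$. Let $G_C$ be the graph obtained from $G$ by attaching a $(2C+1)$-clique to every vertex of $G$, i.e., for each $v\in V(G)$ adding $2C$ new vertices (distinct for different $v$) that together with $v$ form a clique. Then $\rho(G_C)=\rho(G)/(2C+1)+C$.
   Context: For a graph $H$ and nonempty $S\subseteq V(H)$, the density is $\rho(S)=e(S)/|S|$, where $e(S)$ is the number of edges of $H$ with both endpoints in $S$; the maximum density of $H$ is $\rho(H)=\max_{\emptyset\ne S\subseteq V(H)}\rho(S)$. -}

module Defs where

open import Data.Bool using (Bool; true; false; _∧_; if_then_else_)
open import Data.Nat as ℕ using (ℕ; zero; suc)
open import Data.Fin as Fin using (Fin; toℕ; remQuot)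
open import Data.Fin.Subset using (Subset; inside; outside; _∈_; ∣_∣)
open import Data.Vec using ([]; _∷_; lookup)
open import Data.List using (List; []; _∷_; map; _++_; foldr; allFin)
open import Data.Nat.ListAction using (sum)
open import Data.Product using (_×_; _,_)
open import Data.Rational as ℚ using (ℚ; 0ℚ; _/_; _⊔_)
open import Data.Integer using (+_)
open import Relation.Binary.PropositionalEquality using (_≡_)
open import Relation.Nullary.Decidable using (⌊_⌋)

Adj : ℕ → Set
Adj n = Fin n → Fin n → Bool

record Graph (n : ℕ) : Set where
  field
    adj    : Adj n
    sym    : ∀ i j → adj i j ≡ adj j i
    irrefl : ∀ i → adj i i ≡ false
open Graph public

mem : ∀ {n} → Subset n → Fin n → Bool
mem S i = isIn (lookup S i)
  where
  isIn : _ → Bool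
  isIn inside  = true
  isIn outside = false

count : ∀ {A : Set} → (A → Bool) → List A → ℕ
count p xs = sum (map (λ x → if p x then 1 else 0) xs)

edgesIn : ∀ {n} → Adj n → Subset n → ℕ
edgesIn {n} A S =
  sum (map (λ i → count (λ j → ⌊ toℕ i ℕ.<? toℕ j ⌋ ∧ mem S i ∧ mem S j ∧ A i j) (allFin n))
           (allFin n))

-- ρ(S) = e(S)/|S| (for the empty set, which is never used below, we put 0)
density : ∀ {n} → Adj n → Subset n → ℚ
density A S with ∣ S ∣
... | zero  = 0ℚ
... | suc k = (+ edgesIn A S) / suc k

allSubsets : ∀ n → List (Subset n)
allSubsets zero    = [] ∷ []
allSubsets (suc n) = map (inside ∷_) (allSubsets n) ++ map (outside ∷_) (allSubsets n)

nonemptySubsets : ∀ n → List (Subset n)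
nonemptySubsets n = go (allSubsets n)
  where
  go : List (Subset n) → List (Subset n)
  go [] = []
  go (S ∷ Ss) with ∣ S ∣
  ... | zero  = go Ss
  ... | suc _ = S ∷ go Ss

maxList : ℚ → List ℚ → ℚ
maxList d []       = d
maxList d (x ∷ xs) = foldr _⊔_ x xs

-- ρ(H) = max over nonempty S of ρ(S)  (meaningful for n ≥ 1)
maxDensity : ∀ {n} → Adj n → ℚ
maxDensity {n} A = maxList 0ℚ (map (density A) (nonemptySubsets n))

-- G_C: vertex set Fin (n * (2C+1)); vertex x corresponds to (v , k) = remQuot x,
-- k = 0 is the original vertex v, k = 1..2C are the 2C new vertices attached to v.
cliqueAdj : ∀ {n} C → Graph n → Adj (n ℕ.* suc (2 ℕ.* C))
cliqueAdj {n} C G x y with remQuot {n} (suc (2 ℕ.* C)) x | remQuot {n} (suc (2 ℕ.* C)) y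
... | (v , Fin.zero) | (w , Fin.zero) = adj G v w
... | (v , k)        | (w , l)        = ⌊ v Fin.≟ w ⌋ ∧ Data.Bool.not ⌊ k Fin.≟ l ⌋
  where import Data.Bool

-- Let m = 2C + 1. For S ⊆ V(G_C) let T be the set of original vertices in S and a_v the number of
-- vertices of S in the clique at v. Counting ordered pairs gives 2e(S) + |S| = 2e_G(T) + Σ_v a_v².
-- If ρ(G) = E/V is attained then e_G(T)·V ≤ E·|T|, so mV·(2e(S) + |S|) is at most a sum of one term
-- 2mE·[v ∈ T] + mV·a_v² per clique; as a_v ≤ m and 2E ≤ mV (the hypothesis), each term is at most
-- (2E + m²V)·a_v, which rearranges to e(S)/|S| ≤ E/(mV) + C. Adding every clique in full to a
-- densest set of G gives equality.
module Submission where

module CliqueBlowUpDensity where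

  open import Data.Bool using (Bool; true; false; _∧_; not; if_then_else_)
  open import Data.Bool.Properties using (∧-identityʳ; ∧-zeroʳ)
  open import Data.Empty using (⊥-elim)
  open import Data.Fin using (Fin; zero; suc; toℕ; combine; remQuot; _↑ˡ_; _↑ʳ_; _≟_)
  open import Data.Fin.Properties using (remQuot-combine; combine-remQuot; combine-injective; toℕ-injective)
  open import Data.Fin.Subset using (Subset; ∣_∣)
  open import Data.Integer as ℤ using (ℤ)
  import Data.Integer.Properties as ℤ
  open import Data.Integer.Solver renaming (module +-*-Solver to ℤ-Solver)
  open import Data.List as List using (List; []; _∷_; tabulate; map; allFin)
  open import Data.List.Membership.Propositional using (_∈_)
  open import Data.List.Membership.Propositional.Properties using (∈-map⁺; ∈-map⁻; ∈-++⁺ˡ; ∈-++⁺ʳ)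
  open import Data.List.Properties using (map-tabulate)
  open import Data.List.Relation.Unary.Any using (here; there)
  open import Data.Nat as ℕ using (ℕ; zero; suc; pred; _+_; _*_; _≤_; z≤n)
  open import Data.Nat.ListAction using () renaming (sum to listSum)
  open import Data.Nat.Properties
    using ( +-*-semiring; +-identityʳ; +-assoc; *-identityˡ; *-identityʳ; *-assoc; *-comm
          ; *-distribˡ-+; *-distribʳ-+; ≤-refl; ≤-trans; ≤-reflexive; ≤-antisym; <-asym; ≮⇒≥
          ; +-mono-≤; +-monoˡ-≤; +-monoʳ-≤; *-monoˡ-≤; *-monoʳ-≤; m≤n+m; m≤m*n; m≤n*m; n≤0⇒n≡0
          ; m≤n⇒∃[o]m+o≡n; +-cancelʳ-≤; *-cancelˡ-≤; +-cancelʳ-≡; *-cancelˡ-≡; module ≤-Reasoning )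
  open import Data.Nat.Solver using (module +-*-Solver)
  open import Data.Product using (_,_; proj₁; proj₂; _×_; ∃; ∃₂)
  open import Data.Rational as ℚ using (ℚ; _/_; toℚᵘ)
  import Data.Rational.Properties as ℚ
  open import Data.Rational.Unnormalised as ℚᵘ using (mkℚᵘ; *≡*; *≤*)
  import Data.Rational.Unnormalised.Properties as ℚᵘ
  open import Data.Sum using (inj₁; inj₂)
  open import Data.Vec using ([]; _∷_)
  import Data.Vec as Vec
  open import Data.Vec.Properties using (lookup∘tabulate; tabulate-cong)
  open import Defs hiding (sym)
  open import Function using (_∘_; mk⇔)
  open import Relation.Binary.PropositionalEquality
    using (_≡_; refl; sym; trans; cong; cong₂; subst; subst₂; module ≡-Reasoning)
  open import Relation.Nullary.Decidable using (⌊_⌋; yes; no; does-⇔; ⌊⌋-map′; isYes≗does; dec-true)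
  open import Algebra.Properties.Semiring.Sum +-*-semiring
    using (sum; sum-syntax; sum-cong-≗; sum-replicate-zero; ∑-distrib-+; ∑-comm; *-distribˡ-sum; *-distribʳ-sum)

  -- Indicators and finite sums

  [_] : Bool → ℕ
  [ b ] = if b then 1 else 0

  []-≤1 : ∀ b → [ b ] ≤ 1
  []-≤1 true  = ≤-refl
  []-≤1 false = z≤n

  []-idem : ∀ b → [ b ] * [ b ] ≡ [ b ]
  []-idem true  = refl
  []-idem false = refl

  []-∧ : ∀ a b → [ a ∧ b ] ≡ [ a ] * [ b ]
  []-∧ true  b = sym (+-identityʳ [ b ])
  []-∧ false b = refl

  []-∧-split : ∀ a b → [ a ∧ not b ] + [ a ∧ b ] ≡ [ a ]
  []-∧-split false b     = refl
  []-∧-split true  false = refl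
  []-∧-split true  true  = refl

  ∑-mono-≤ : ∀ {n} {f g : Fin n → ℕ} → (∀ i → f i ≤ g i) → sum f ≤ sum g
  ∑-mono-≤ {zero}  _   = z≤n
  ∑-mono-≤ {suc n} f≤g = +-mono-≤ (f≤g zero) (∑-mono-≤ (f≤g ∘ suc))

  ∑-const : ∀ n c → ∑[ i < n ] c ≡ n * c
  ∑-const zero    c = refl
  ∑-const (suc n) c = cong (c +_) (∑-const n c)

  ∑-[]-≤ : ∀ {n} (p : Fin n → Bool) → ∑[ i < n ] [ p i ] ≤ n
  ∑-[]-≤ {n} p = ≤-trans (∑-mono-≤ ([]-≤1 ∘ p)) (≤-reflexive (trans (∑-const n 1) (*-identityʳ n)))

  ∑-δ : ∀ {n} (f : Fin n → ℕ) (x : Fin n) → ∑[ y < n ] ([ ⌊ x ≟ y ⌋ ] * f y) ≡ f x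
  ∑-δ {suc n} f zero    = trans (cong₂ _+_ (*-identityˡ (f zero)) (sum-replicate-zero n)) (+-identityʳ (f zero))
  ∑-δ {suc n} f (suc x) =
    trans (sum-cong-≗ (λ y → cong (λ b → [ b ] * f (suc y)) (⌊⌋-map′ _ _ (x ≟ y)))) (∑-δ (f ∘ suc) x)

  ∑-↑ : ∀ a b (f : Fin (a + b) → ℕ) → sum f ≡ ∑[ i < a ] f (i ↑ˡ b) + ∑[ j < b ] f (a ↑ʳ j)
  ∑-↑ zero    b f = refl
  ∑-↑ (suc a) b f = trans (cong (f zero +_) (∑-↑ a b (f ∘ suc))) (sym (+-assoc (f zero) _ _))

  ∑-combine : ∀ n m (f : Fin (n * m) → ℕ) → sum f ≡ ∑[ v < n ] ∑[ k < m ] f (combine v k)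
  ∑-combine zero    m f = refl
  ∑-combine (suc n) m f =
    trans (∑-↑ m (n * m) f) (cong (∑[ k < m ] f (k ↑ˡ (n * m)) +_) (∑-combine n m (f ∘ (m ↑ʳ_))))

  ∑-combine-remQuot : ∀ n m (h : Fin n → ℕ) (f : Fin (n * m) → ℕ) →
    ∑[ x < n * m ] (h (proj₁ (remQuot m x)) * f x) ≡ ∑[ v < n ] (h v * ∑[ k < m ] f (combine v k))
  ∑-combine-remQuot n m h f = begin
    ∑[ x < n * m ] (h (proj₁ (remQuot m x)) * f x)
      ≡⟨ ∑-combine n m _ ⟩
    ∑[ v < n ] ∑[ k < m ] (h (proj₁ (remQuot m (combine v k))) * f (combine v k))
      ≡⟨ sum-cong-≗ (λ v → sum-cong-≗ (λ k →
           cong (λ p → h (proj₁ p) * f (combine v k)) (remQuot-combine v k))) ⟩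
    ∑[ v < n ] ∑[ k < m ] (h v * f (combine v k))
      ≡⟨ sum-cong-≗ (λ v → sym (*-distribˡ-sum (h v) (f ∘ combine v))) ⟩
    ∑[ v < n ] (h v * ∑[ k < m ] f (combine v k)) ∎
    where open ≡-Reasoning

  sum-tabulate : ∀ {n} (f : Fin n → ℕ) → listSum (tabulate f) ≡ sum f
  sum-tabulate {zero}  f = refl
  sum-tabulate {suc n} f = cong (f zero +_) (sum-tabulate (f ∘ suc))

  sum-map-allFin : ∀ {n} (f : Fin n → ℕ) → listSum (map f (allFin n)) ≡ sum f
  sum-map-allFin {n} f = trans (cong listSum (map-tabulate (λ i → i) f)) (sum-tabulate f)

  quadForm : ∀ {N} → (Fin N → ℕ) → (Fin N → Fin N → ℕ) → ℕ
  quadForm {N} f g = ∑[ x < N ] (f x * ∑[ y < N ] (g x y * f y))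

  quadForm-congʳ : ∀ {N} (f : Fin N → ℕ) {g h : Fin N → Fin N → ℕ} →
    (∀ x y → g x y ≡ h x y) → quadForm f g ≡ quadForm f h
  quadForm-congʳ f g≡h = sum-cong-≗ (λ x → cong (f x *_) (sum-cong-≗ (λ y → cong (_* f y) (g≡h x y))))

  quadForm-congˡ : ∀ {N} {f f′ : Fin N → ℕ} → (∀ x → f x ≡ f′ x) →
    ∀ g → quadForm f g ≡ quadForm f′ g
  quadForm-congˡ f≡f′ g =
    sum-cong-≗ (λ x → cong₂ _*_ (f≡f′ x) (sum-cong-≗ (λ y → cong (g x y *_) (f≡f′ y))))

  quadForm-+ : ∀ {N} (f : Fin N → ℕ) (g h : Fin N → Fin N → ℕ) →
    quadForm f (λ x y → g x y + h x y) ≡ quadForm f g + quadForm f h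
  quadForm-+ {N} f g h = trans (sum-cong-≗ distrib) (∑-distrib-+ (row g) (row h))
    where
    distrib : ∀ x → f x * ∑[ y < N ] ((g x y + h x y) * f y)
                  ≡ f x * ∑[ y < N ] (g x y * f y) + f x * ∑[ y < N ] (h x y * f y)
    distrib x = trans (cong (f x *_) (trans (sum-cong-≗ (λ y → *-distribʳ-+ (f y) (g x y) (h x y)))
                                                 (∑-distrib-+ (λ y → g x y * f y) (λ y → h x y * f y))))
                      (*-distribˡ-+ (f x) _ _)
    row : (Fin N → Fin N → ℕ) → Fin N → ℕ
    row k x = f x * ∑[ y < N ] (k x y * f y)

  quadForm-δ : ∀ {N} (f : Fin N → ℕ) → quadForm f (λ x y → [ ⌊ x ≟ y ⌋ ]) ≡ ∑[ x < N ] (f x * f x)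
  quadForm-δ f = sum-cong-≗ (λ x → cong (f x *_) (∑-δ f x))

  quadForm-≤ : ∀ {N} (f : Fin N → ℕ) {g : Fin N → Fin N → ℕ} →
    (∀ x y → g x y ≤ 1) → quadForm f g ≤ sum f * sum f
  quadForm-≤ {N} f {g} g≤1 = begin
    quadForm f g
      ≤⟨ ∑-mono-≤ (λ x → *-monoʳ-≤ (f x) (∑-mono-≤ (λ y → *-monoˡ-≤ (f y) (g≤1 x y)))) ⟩
    ∑[ x < N ] (f x * ∑[ y < N ] (1 * f y))
      ≡⟨ sum-cong-≗ (λ x → cong (f x *_) (sum-cong-≗ (*-identityˡ ∘ f))) ⟩
    ∑[ x < N ] (f x * sum f)
      ≡⟨ *-distribʳ-sum (sum f) f ⟨
    sum f * sum f ∎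
    where open ≤-Reasoning

  quadForm-rescale : ∀ {N} (f u : Fin N → ℕ) (g : Fin N → Fin N → ℕ) →
    quadForm f (λ x y → u x * u y * g x y) ≡ quadForm (λ x → f x * u x) g
  quadForm-rescale {N} f u g = sum-cong-≗ rescale
    where
    open +-*-Solver
    rescale : ∀ x →
      f x * ∑[ y < N ] (u x * u y * g x y * f y) ≡ f x * u x * ∑[ y < N ] (g x y * (f y * u y))
    rescale x = begin
      f x * ∑[ y < N ] (u x * u y * g x y * f y)
        ≡⟨ cong (f x *_) (sum-cong-≗ (λ y → solve 4 (λ a b c d → a :* b :* c :* d := a :* (c :* (d :* b))) refl
                                                    (u x) (u y) (g x y) (f y))) ⟩
      f x * ∑[ y < N ] (u x * (g x y * (f y * u y)))
        ≡⟨ cong (f x *_) (*-distribˡ-sum (u x) (λ y → g x y * (f y * u y))) ⟨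
      f x * (u x * ∑[ y < N ] (g x y * (f y * u y)))
        ≡⟨ *-assoc (f x) (u x) _ ⟨
      f x * u x * ∑[ y < N ] (g x y * (f y * u y)) ∎
      where open ≡-Reasoning

  quadForm-remQuot : ∀ n m (f : Fin (n * m) → ℕ) (g : Fin n → Fin n → ℕ) →
    quadForm f (λ x y → g (proj₁ (remQuot m x)) (proj₁ (remQuot m y)))
      ≡ quadForm (λ v → ∑[ k < m ] f (combine v k)) g
  quadForm-remQuot n m f g = begin
    ∑[ x < n * m ] (f x * ∑[ y < n * m ] (g (root x) (root y) * f y))
      ≡⟨ sum-cong-≗ (λ x → cong (f x *_) (∑-combine-remQuot n m (g (root x)) f)) ⟩
    ∑[ x < n * m ] (f x * h (root x))
      ≡⟨ sum-cong-≗ (λ x → *-comm (f x) (h (root x))) ⟩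
    ∑[ x < n * m ] (h (root x) * f x)
      ≡⟨ ∑-combine-remQuot n m h f ⟩
    ∑[ v < n ] (h v * F v)
      ≡⟨ sum-cong-≗ (λ v → *-comm (h v) (F v)) ⟩
    ∑[ v < n ] (F v * h v) ∎
    where
    open ≡-Reasoning
    root : Fin (n * m) → Fin n
    root x = proj₁ (remQuot m x)
    F : Fin n → ℕ
    F v = ∑[ k < m ] f (combine v k)
    h : Fin n → ℕ
    h v = ∑[ w < n ] (g v w * F w)

  -- Counting edges

  mem-tabulate : ∀ {n} (p : Fin n → Bool) i → mem (Vec.tabulate p) i ≡ p i
  mem-tabulate p i rewrite lookup∘tabulate p i with p i
  ... | true  = refl
  ... | false = refl

  tabulate-mem : ∀ {n} (S : Subset n) → Vec.tabulate (mem S) ≡ S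
  tabulate-mem []          = refl
  tabulate-mem (true ∷ S)  = cong (true ∷_) (tabulate-mem S)
  tabulate-mem (false ∷ S) = cong (false ∷_) (tabulate-mem S)

  ∣∣≡∑mem : ∀ {n} (S : Subset n) → ∣ S ∣ ≡ ∑[ i < n ] [ mem S i ]
  ∣∣≡∑mem []          = refl
  ∣∣≡∑mem (true ∷ S)  = cong suc (∣∣≡∑mem S)
  ∣∣≡∑mem (false ∷ S) = ∣∣≡∑mem S

  _≺_ : ∀ {n} → Fin n → Fin n → Bool
  i ≺ j = ⌊ toℕ i ℕ.<? toℕ j ⌋

  edgesIn-∑ : ∀ {n} (A : Adj n) (S : Subset n) →
    edgesIn A S ≡ ∑[ i < n ] ∑[ j < n ] [ i ≺ j ∧ mem S i ∧ mem S j ∧ A i j ]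
  edgesIn-∑ {n} A S =
    trans (sum-map-allFin (λ i → count (P i) (allFin n))) (sum-cong-≗ (λ i → sum-map-allFin ([_] ∘ P i)))
    where
    P : Fin n → Fin n → Bool
    P i j = i ≺ j ∧ mem S i ∧ mem S j ∧ A i j

  []-split-≺ : ∀ {n} (P : Fin n → Fin n → Bool) → (∀ i → P i i ≡ false) →
    ∀ i j → [ P i j ] ≡ [ i ≺ j ∧ P i j ] + [ j ≺ i ∧ P i j ]
  []-split-≺ P irr i j with toℕ i ℕ.<? toℕ j | toℕ j ℕ.<? toℕ i
  ... | yes i<j | yes j<i = ⊥-elim (<-asym i<j j<i)
  ... | yes _   | no  _   = sym (+-identityʳ _)
  ... | no  _   | yes _   = refl
  ... | no  i≮j | no  j≮i with toℕ-injective (≤-antisym (≮⇒≥ j≮i) (≮⇒≥ i≮j))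
  ...   | refl rewrite irr i = refl

  ∑∑-≺-double : ∀ {n} (P : Fin n → Fin n → Bool) →
    (∀ i j → P i j ≡ P j i) → (∀ i → P i i ≡ false) →
    2 * ∑[ i < n ] ∑[ j < n ] [ i ≺ j ∧ P i j ] ≡ ∑[ i < n ] ∑[ j < n ] [ P i j ]
  ∑∑-≺-double {n} P P-sym P-irr = sym (begin
    ∑[ i < n ] ∑[ j < n ] [ P i j ]
      ≡⟨ sum-cong-≗ (λ i → trans (sum-cong-≗ ([]-split-≺ P P-irr i)) (∑-distrib-+ (below i) (above i))) ⟩
    ∑[ i < n ] (sum (below i) + sum (above i))
      ≡⟨ ∑-distrib-+ (sum ∘ below) (sum ∘ above) ⟩
    half + ∑[ i < n ] sum (above i)
      ≡⟨ cong (half +_) (∑-comm above) ⟩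
    half + ∑[ j < n ] ∑[ i < n ] [ j ≺ i ∧ P i j ]
      ≡⟨ cong (half +_) (sum-cong-≗ (λ j → sum-cong-≗ (λ i → cong (λ b → [ j ≺ i ∧ b ]) (P-sym i j)))) ⟩
    half + half
      ≡⟨ cong (half +_) (+-identityʳ half) ⟨
    2 * half ∎)
    where
    open ≡-Reasoning
    below above : Fin n → Fin n → ℕ
    below i j = [ i ≺ j ∧ P i j ]
    above i j = [ j ≺ i ∧ P i j ]
    half : ℕ
    half = ∑[ i < n ] sum (below i)

  edgesIn-double : ∀ {n} (G : Graph n) (S : Subset n) →
    2 * edgesIn (adj G) S ≡ quadForm (λ i → [ mem S i ]) (λ i j → [ adj G i j ])
  edgesIn-double {n} G S = begin
    2 * edgesIn A S
      ≡⟨ cong (2 *_) (edgesIn-∑ A S) ⟩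
    2 * ∑[ i < n ] ∑[ j < n ] [ i ≺ j ∧ P i j ]
      ≡⟨ ∑∑-≺-double P P-sym P-irr ⟩
    ∑[ i < n ] ∑[ j < n ] [ P i j ]
      ≡⟨ sum-cong-≗ (λ i → trans (sum-cong-≗ (factor i))
                                   (sym (*-distribˡ-sum [ mem S i ] (λ j → [ A i j ] * [ mem S j ])))) ⟩
    quadForm (λ i → [ mem S i ]) (λ i j → [ A i j ]) ∎
    where
    open ≡-Reasoning
    A : Adj n
    A = adj G
    P : Fin n → Fin n → Bool
    P i j = mem S i ∧ mem S j ∧ A i j
    P-sym : ∀ i j → P i j ≡ P j i
    P-sym i j with mem S i | mem S j
    ... | true  | true  = Graph.sym G i j
    ... | true  | false = refl
    ... | false | true  = refl
    ... | false | false = refl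
    P-irr : ∀ i → P i i ≡ false
    P-irr i rewrite Graph.irrefl G i with mem S i
    ... | true  = refl
    ... | false = refl
    factor : ∀ i j → [ P i j ] ≡ [ mem S i ] * ([ A i j ] * [ mem S j ])
    factor i j = trans ([]-∧ (mem S i) _)
                       (cong ([ mem S i ] *_) (trans ([]-∧ (mem S j) (A i j)) (*-comm [ mem S j ] [ A i j ])))

  edgesIn-≤ : ∀ {n} (G : Graph n) (S : Subset n) → 2 * edgesIn (adj G) S ≤ ∣ S ∣ * ∣ S ∣
  edgesIn-≤ {n} G S = begin
    2 * edgesIn (adj G) S
      ≡⟨ edgesIn-double G S ⟩
    quadForm (λ i → [ mem S i ]) (λ i j → [ adj G i j ])
      ≤⟨ quadForm-≤ (λ i → [ mem S i ]) (λ i j → []-≤1 (adj G i j)) ⟩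
    ∑[ i < n ] [ mem S i ] * ∑[ i < n ] [ mem S i ]
      ≡⟨ cong₂ _*_ (∣∣≡∑mem S) (∣∣≡∑mem S) ⟨
    ∣ S ∣ * ∣ S ∣ ∎
    where open ≤-Reasoning

  edgesIn-∅ : ∀ {n} (G : Graph n) (S : Subset n) → ∣ S ∣ ≡ 0 → edgesIn (adj G) S ≡ 0
  edgesIn-∅ G S ∣S∣≡0 =
    n≤0⇒n≡0 (≤-trans (m≤n*m (edgesIn (adj G) S) 2)
                     (subst (λ s → 2 * edgesIn (adj G) S ≤ s * s) ∣S∣≡0 (edgesIn-≤ G S)))

  -- The rationals a/(b+1)

  ratio : ℕ → ℕ → ℚ
  ratio a b = ℤ.+ a / suc b

  toℚᵘ-ratio : ∀ a b → toℚᵘ (ratio a b) ℚᵘ.≃ mkℚᵘ (ℤ.+ a) b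
  toℚᵘ-ratio a b = ℚ.toℚᵘ-fromℚᵘ (mkℚᵘ (ℤ.+ a) b)

  ratio-≤⁺ : ∀ a b c d → a * suc d ≤ c * suc b → ratio a b ℚ.≤ ratio c d
  ratio-≤⁺ a b c d ad≤cb = ℚ.toℚᵘ-cancel-≤
    (ℚᵘ.≤-respˡ-≃ (ℚᵘ.≃-sym (toℚᵘ-ratio a b)) (ℚᵘ.≤-respʳ-≃ (ℚᵘ.≃-sym (toℚᵘ-ratio c d))
      (*≤* (subst₂ ℤ._≤_ (ℤ.pos-* a (suc d)) (ℤ.pos-* c (suc b)) (ℤ.+≤+ ad≤cb)))))

  ratio-≤⁻ : ∀ a b c d → ratio a b ℚ.≤ ratio c d → a * suc d ≤ c * suc b
  ratio-≤⁻ a b c d a/b≤c/d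
    with ℚᵘ.≤-respˡ-≃ (toℚᵘ-ratio a b) (ℚᵘ.≤-respʳ-≃ (toℚᵘ-ratio c d) (ℚ.toℚᵘ-mono-≤ a/b≤c/d))
  ... | *≤* ad≤cb = ℤ.drop‿+≤+ (subst₂ ℤ._≤_ (sym (ℤ.pos-* a (suc d))) (sym (ℤ.pos-* c (suc b))) ad≤cb)

  -- Stated in exactly the shape the ℚᵘ operations produce, so that *≡* accepts it.
  ratio-affine-cross : ∀ e k c d →
    ((ℤ.+ e ℤ.* ℤ.+ 1) ℤ.* ℤ.+ 1 ℤ.+ ℤ.+ c ℤ.* ℤ.+ (suc k * suc d)) ℤ.* ℤ.+ (suc d * suc k)
      ≡ ℤ.+ (e + c * (suc d * suc k)) ℤ.* ℤ.+ (suc k * suc d * 1)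
  ratio-affine-cross e k c d = begin
    ((ℤ.+ e ℤ.* ℤ.+ 1) ℤ.* ℤ.+ 1 ℤ.+ ℤ.+ c ℤ.* ℤ.+ (suc k * suc d)) ℤ.* Q
      ≡⟨ cong (λ x → ((ℤ.+ e ℤ.* ℤ.+ 1) ℤ.* ℤ.+ 1 ℤ.+ ℤ.+ c ℤ.* ℤ.+ x) ℤ.* Q)
              (*-comm (suc k) (suc d)) ⟩
    ((ℤ.+ e ℤ.* ℤ.+ 1) ℤ.* ℤ.+ 1 ℤ.+ ℤ.+ c ℤ.* Q) ℤ.* Q
      ≡⟨ solve 3 (λ e c Q → ((e :* con (ℤ.+ 1)) :* con (ℤ.+ 1) :+ c :* Q) :* Q := (e :+ c :* Q) :* Q)
                 refl (ℤ.+ e) (ℤ.+ c) Q ⟩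
    (ℤ.+ e ℤ.+ ℤ.+ c ℤ.* Q) ℤ.* Q
      ≡⟨ cong₂ ℤ._*_ (sym (trans (ℤ.pos-+ e _) (cong (ℤ._+_ (ℤ.+ e)) (ℤ.pos-* c _))))
                     (cong ℤ.+_ (trans (*-comm (suc d) (suc k)) (sym (*-identityʳ _)))) ⟩
    ℤ.+ (e + c * (suc d * suc k)) ℤ.* ℤ.+ (suc k * suc d * 1) ∎
    where
    open ≡-Reasoning
    open ℤ-Solver
    Q : ℤ
    Q = ℤ.+ (suc d * suc k)

  ratio-affine : ∀ e k c d →
    ratio e k ℚ.* ratio 1 d ℚ.+ ratio c 0 ≡ ratio (e + c * (suc d * suc k)) (pred (suc d * suc k))
  ratio-affine e k c d = ℚ.toℚᵘ-injective (begin-equality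
    toℚᵘ (ratio e k ℚ.* ratio 1 d ℚ.+ ratio c 0)
      ≃⟨ ℚ.toℚᵘ-homo-+ (ratio e k ℚ.* ratio 1 d) (ratio c 0) ⟩
    toℚᵘ (ratio e k ℚ.* ratio 1 d) ℚᵘ.+ toℚᵘ (ratio c 0)
      ≃⟨ ℚᵘ.+-cong (ℚᵘ.≃-trans (ℚ.toℚᵘ-homo-* (ratio e k) (ratio 1 d))
                               (ℚᵘ.*-cong (toℚᵘ-ratio e k) (toℚᵘ-ratio 1 d)))
                   (toℚᵘ-ratio c 0) ⟩
    mkℚᵘ (ℤ.+ e) k ℚᵘ.* mkℚᵘ (ℤ.+ 1) d ℚᵘ.+ mkℚᵘ (ℤ.+ c) 0
      ≃⟨ *≡* (ratio-affine-cross e k c d) ⟩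
    mkℚᵘ (ℤ.+ (e + c * (suc d * suc k))) (pred (suc d * suc k))
      ≃⟨ ℚᵘ.≃-sym (toℚᵘ-ratio _ _) ⟩
    toℚᵘ (ratio (e + c * (suc d * suc k)) (pred (suc d * suc k))) ∎)
    where open ℚᵘ.≤-Reasoning

  -- Maximum density

  density-suc : ∀ {n} (A : Adj n) (S : Subset n) {k} → ∣ S ∣ ≡ suc k → density A S ≡ ratio (edgesIn A S) k
  density-suc A S ∣S∣≡1+k rewrite ∣S∣≡1+k = refl

  allSubsets-complete : ∀ {n} (S : Subset n) → S ∈ allSubsets n
  allSubsets-complete []                = here refl
  allSubsets-complete {suc n} (true ∷ S)  = ∈-++⁺ˡ (∈-map⁺ (true ∷_) (allSubsets-complete S))
  allSubsets-complete {suc n} (false ∷ S) =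
    ∈-++⁺ʳ (List.map (true ∷_) (allSubsets n)) (∈-map⁺ (false ∷_) (allSubsets-complete S))

  -- The filter inside nonemptySubsets is local to its where-block; this equation names it by unification.
  mutual
    keepNonempty : ∀ n → List (Subset n) → List (Subset n)
    keepNonempty = _

    nonemptySubsets-keepNonempty : ∀ n → nonemptySubsets n ≡ keepNonempty n (allSubsets n)
    nonemptySubsets-keepNonempty n with allSubsets n
    ... | Ss = refl

  keepNonempty⁺ : ∀ {n} {S : Subset n} {k} Ss → ∣ S ∣ ≡ suc k → S ∈ Ss → S ∈ keepNonempty n Ss
  keepNonempty⁺ (T ∷ Ss) ∣S∣≡1+k (here refl) with ∣ T ∣
  keepNonempty⁺ (T ∷ Ss) () (here refl) | zero
  ... | suc _ = here refl
  keepNonempty⁺ (T ∷ Ss) ∣S∣≡1+k (there S∈Ss) with ∣ T ∣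
  ... | zero  = keepNonempty⁺ Ss ∣S∣≡1+k S∈Ss
  ... | suc _ = there (keepNonempty⁺ Ss ∣S∣≡1+k S∈Ss)

  keepNonempty⁻ : ∀ {n} {S : Subset n} Ss → S ∈ keepNonempty n Ss → ∃ λ k → ∣ S ∣ ≡ suc k
  keepNonempty⁻ (T ∷ Ss) S∈ with ∣ T ∣ in ∣T∣≡
  ... | zero  = keepNonempty⁻ Ss S∈
  ... | suc k with S∈
  ...   | here refl = k , ∣T∣≡
  ...   | there S∈′ = keepNonempty⁻ Ss S∈′

  ∈-nonemptySubsets⁺ : ∀ {n} (S : Subset n) {k} → ∣ S ∣ ≡ suc k → S ∈ nonemptySubsets n
  ∈-nonemptySubsets⁺ {n} S ∣S∣≡1+k = subst (S ∈_) (sym (nonemptySubsets-keepNonempty n))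
    (keepNonempty⁺ (allSubsets n) ∣S∣≡1+k (allSubsets-complete S))

  ∈-nonemptySubsets⁻ : ∀ {n} {S : Subset n} → S ∈ nonemptySubsets n → ∃ λ k → ∣ S ∣ ≡ suc k
  ∈-nonemptySubsets⁻ {n} S∈ = keepNonempty⁻ (allSubsets n) (subst (_ ∈_) (nonemptySubsets-keepNonempty n) S∈)

  foldr-⊔-∈ : ∀ x xs → List.foldr ℚ._⊔_ x xs ∈ x ∷ xs
  foldr-⊔-∈ x []       = here refl
  foldr-⊔-∈ x (y ∷ ys) with ℚ.⊔-sel y (List.foldr ℚ._⊔_ x ys)
  ... | inj₁ y⊔r≡y rewrite y⊔r≡y = there (here refl)
  ... | inj₂ y⊔r≡r rewrite y⊔r≡r with foldr-⊔-∈ x ys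
  ...   | here r≡x   = here r≡x
  ...   | there r∈ys = there (there r∈ys)

  foldr-⊔-upper : ∀ x xs {y} → y ∈ x ∷ xs → y ℚ.≤ List.foldr ℚ._⊔_ x xs
  foldr-⊔-upper x []       (here refl)         = ℚ.≤-refl
  foldr-⊔-upper x (z ∷ zs) (here refl)         = ℚ.≤-trans (foldr-⊔-upper x zs (here refl)) (ℚ.p≤q⊔p z _)
  foldr-⊔-upper x (z ∷ zs) (there (here refl)) = ℚ.p≤p⊔q z _
  foldr-⊔-upper x (z ∷ zs) (there (there y∈)) = ℚ.≤-trans (foldr-⊔-upper x zs (there y∈)) (ℚ.p≤q⊔p z _)

  maxList-upper : ∀ d xs {y} → y ∈ xs → y ℚ.≤ maxList d xs
  maxList-upper d (x ∷ xs) y∈ = foldr-⊔-upper x xs y∈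

  maxList-∈ : ∀ d xs {y} → y ∈ xs → maxList d xs ∈ xs
  maxList-∈ d (x ∷ xs) _ = foldr-⊔-∈ x xs

  density≤maxDensity : ∀ {n} (A : Adj n) (S : Subset n) {k} → ∣ S ∣ ≡ suc k →
    ratio (edgesIn A S) k ℚ.≤ maxDensity A
  density≤maxDensity {n} A S ∣S∣≡1+k = subst (ℚ._≤ maxDensity A) (density-suc A S ∣S∣≡1+k) ρS≤max
    where
    ρS≤max : density A S ℚ.≤ maxDensity A
    ρS≤max = maxList-upper ℚ.0ℚ (List.map (density A) (nonemptySubsets n))
                           (∈-map⁺ (density A) (∈-nonemptySubsets⁺ S ∣S∣≡1+k))

  maxDensity-∈ : ∀ {n} (A : Adj n) (S : Subset n) {k} → ∣ S ∣ ≡ suc k →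
    maxDensity A ∈ List.map (density A) (nonemptySubsets n)
  maxDensity-∈ {n} A S ∣S∣≡1+k =
    maxList-∈ ℚ.0ℚ (List.map (density A) (nonemptySubsets n))
                   (∈-map⁺ (density A) (∈-nonemptySubsets⁺ S ∣S∣≡1+k))

  maxDensity-attained : ∀ {n} (A : Adj n) (S : Subset n) {k} → ∣ S ∣ ≡ suc k →
    ∃₂ λ T j → ∣ T ∣ ≡ suc j × maxDensity A ≡ ratio (edgesIn A T) j
  maxDensity-attained {n} A S ∣S∣≡1+k = attained (∈-map⁻ (density A) (maxDensity-∈ A S ∣S∣≡1+k))
    where
    attained : (∃ λ T → T ∈ nonemptySubsets n × maxDensity A ≡ density A T) →
      ∃₂ λ T j → ∣ T ∣ ≡ suc j × maxDensity A ≡ ratio (edgesIn A T) j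
    attained (T , T∈ , max≡ρT) =
      let j , ∣T∣≡1+j = ∈-nonemptySubsets⁻ T∈
      in T , j , ∣T∣≡1+j , trans max≡ρT (density-suc A T ∣T∣≡1+j)

  maxDensity-unique : ∀ {n} (A : Adj n) (S : Subset n) {k q} →
    ∣ S ∣ ≡ suc k → ratio (edgesIn A S) k ≡ q →
    (∀ T j → ∣ T ∣ ≡ suc j → ratio (edgesIn A T) j ℚ.≤ q) → maxDensity A ≡ q
  maxDensity-unique A S {q = q} ∣S∣≡1+k ρS≡q upper = ℚ.≤-antisym max≤q q≤max
    where
    max≤q : maxDensity A ℚ.≤ q
    max≤q = let T , j , ∣T∣≡1+j , max≡ρT = maxDensity-attained A S ∣S∣≡1+k
            in subst (ℚ._≤ q) (sym max≡ρT) (upper T j ∣T∣≡1+j)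
    q≤max : q ℚ.≤ maxDensity A
    q≤max = subst (ℚ._≤ maxDensity A) ρS≡q (density≤maxDensity A S ∣S∣≡1+k)

  edgesIn-≤-maxDensity : ∀ {n} (G : Graph n) {E k} → maxDensity (adj G) ≡ ratio E k →
    ∀ T → edgesIn (adj G) T * suc k ≤ E * ∣ T ∣
  edgesIn-≤-maxDensity G {E} {k} max≡ T with ∣ T ∣ in ∣T∣≡
  ... | zero  = subst (λ e → e * suc k ≤ E * 0) (sym (edgesIn-∅ G T ∣T∣≡)) z≤n
  ... | suc j = ratio-≤⁻ (edgesIn (adj G) T) j E k
                  (subst (ratio (edgesIn (adj G) T) j ℚ.≤_) max≡ (density≤maxDensity (adj G) T ∣T∣≡))

  -- The clique blow-up

  ⌊≟⌋-sym : ∀ {k} (i j : Fin k) → ⌊ i ≟ j ⌋ ≡ ⌊ j ≟ i ⌋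
  ⌊≟⌋-sym i j =
    trans (isYes≗does (i ≟ j)) (trans (does-⇔ (mk⇔ sym sym) (i ≟ j) (j ≟ i)) (sym (isYes≗does (j ≟ i))))

  ⌊≟⌋-refl : ∀ {k} (i : Fin k) → ⌊ i ≟ i ⌋ ≡ true
  ⌊≟⌋-refl i = trans (isYes≗does (i ≟ i)) (dec-true (i ≟ i) refl)

  ⌊combine≟combine⌋ : ∀ {n m} (v : Fin n) (k : Fin m) w l →
    ⌊ combine v k ≟ combine w l ⌋ ≡ ⌊ v ≟ w ⌋ ∧ ⌊ k ≟ l ⌋
  ⌊combine≟combine⌋ v k w l with combine v k ≟ combine w l | v ≟ w | k ≟ l
  ... | yes _     | yes _    | yes _    = refl
  ... | no  _     | no  _    | _        = refl
  ... | no  _     | yes _    | no  _    = refl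
  ... | no  vk≢wl | yes refl | yes refl = ⊥-elim (vk≢wl refl)
  ... | yes vk≡wl | no  v≢w  | _        = ⊥-elim (v≢w (proj₁ (combine-injective v k w l vk≡wl)))
  ... | yes vk≡wl | yes _    | no  k≢l  = ⊥-elim (k≢l (proj₂ (combine-injective v k w l vk≡wl)))

  -- One clique of G_C: t says whether its root lies in S and b counts its other vertices in S;
  -- the bound is applied with D = 2E and M = (2C+1)V.
  cliqueContribution-≤ : ∀ {c D M b} t → b ≤ c → D ≤ M →
    suc c * (D * [ t ]) + M * (([ t ] + b) * ([ t ] + b)) ≤ (D + suc c * M) * ([ t ] + b)
  cliqueContribution-≤ {c} {D} {M} {b} false b≤c _ = begin
    suc c * (D * 0) + M * (b * b)
      ≡⟨ solve 4 (λ c D M b → (con 1 :+ c) :* (D :* con 0) :+ M :* (b :* b) := b :* M :* b) refl c D M b ⟩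
    b * M * b
      ≤⟨ *-monoˡ-≤ b (*-monoˡ-≤ M b≤c) ⟩
    c * M * b
      ≤⟨ *-monoˡ-≤ b (≤-trans (m≤n+m (c * M) M) (m≤n+m (suc c * M) D)) ⟩
    (D + suc c * M) * b ∎
    where
    open ≤-Reasoning
    open +-*-Solver
  cliqueContribution-≤ {D = D} {M} {b} true b≤c D≤M with m≤n⇒∃[o]m+o≡n b≤c
  ... | r , refl = begin
    suc (b + r) * (D * 1) + M * (suc b * suc b)
      ≡⟨ solve 4 (λ D M b r → (con 1 :+ (b :+ r)) :* (D :* con 1) :+ M :* ((con 1 :+ b) :* (con 1 :+ b))
                             := P′ D M b :+ r :* D) refl D M b r ⟩
    P + r * D
      ≤⟨ +-monoʳ-≤ P (*-monoʳ-≤ r (≤-trans D≤M (m≤m*n M (suc b)))) ⟩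
    P + r * (M * suc b)
      ≡⟨ solve 4 (λ D M b r → P′ D M b :+ r :* (M :* (con 1 :+ b))
                             := (D :+ (con 1 :+ (b :+ r)) :* M) :* (con 1 :+ b)) refl D M b r ⟩
    (D + suc (b + r) * M) * suc b ∎
    where
    open ≤-Reasoning
    open +-*-Solver
    P′ : ∀ {k} → Polynomial k → Polynomial k → Polynomial k → Polynomial k
    P′ D M b = D :* (con 1 :+ b) :+ M :* ((con 1 :+ b) :* (con 1 :+ b))
    P : ℕ
    P = D * suc b + M * (suc b * suc b)

  module CliqueBlowUp (C : ℕ) {n : ℕ} (G : Graph n) where

    m : ℕ
    m = suc (2 * C)

    A : Adj n
    A = adj G

    H : Adj (n * m)
    H = cliqueAdj C G

    root : Fin (n * m) → Fin n
    root x = proj₁ (remQuot {n} m x)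

    layer : Fin (n * m) → Fin m
    layer x = proj₂ (remQuot {n} m x)

    isRoot : Fin (n * m) → Bool
    isRoot x = ⌊ zero ≟ layer x ⌋

    cliqueAdj-sym : ∀ x y → H x y ≡ H y x
    cliqueAdj-sym x y with remQuot {n} m x | remQuot {n} m y
    ... | v , zero  | w , zero  = Graph.sym G v w
    ... | v , zero  | w , suc _ = cong (_∧ true) (⌊≟⌋-sym v w)
    ... | v , suc _ | w , zero  = cong (_∧ true) (⌊≟⌋-sym v w)
    ... | v , suc k | w , suc l = cong₂ (λ a b → a ∧ not b) (⌊≟⌋-sym v w) (⌊≟⌋-sym (suc k) (suc l))

    cliqueAdj-irrefl : ∀ x → H x x ≡ false
    cliqueAdj-irrefl x with remQuot {n} m x
    ... | v , zero  = Graph.irrefl G v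
    ... | v , suc k rewrite ⌊≟⌋-refl (suc k) = ∧-zeroʳ ⌊ v ≟ v ⌋

    cliqueGraph : Graph (n * m)
    cliqueGraph = record { adj = H ; sym = cliqueAdj-sym ; irrefl = cliqueAdj-irrefl }

    cliqueAdj-indicator-combine : ∀ v k w l →
      [ H (combine v k) (combine w l) ] + [ ⌊ combine v k ≟ combine w l ⌋ ]
        ≡ [ ⌊ zero ≟ k ⌋ ] * [ ⌊ zero ≟ l ⌋ ] * [ A v w ] + [ ⌊ v ≟ w ⌋ ]
    cliqueAdj-indicator-combine v k w l
      rewrite remQuot-combine {n} v k | remQuot-combine {n} w l | ⌊combine≟combine⌋ v k w l
      with k | l
    ... | zero  | zero  = cong₂ _+_ (sym (*-identityˡ [ A v w ])) (cong [_] (∧-identityʳ ⌊ v ≟ w ⌋))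
    ... | zero  | suc _ = []-∧-split ⌊ v ≟ w ⌋ false
    ... | suc k | l     = []-∧-split ⌊ v ≟ w ⌋ ⌊ suc k ≟ l ⌋

    cliqueAdj-indicator : ∀ x y →
      [ H x y ] + [ ⌊ x ≟ y ⌋ ]
        ≡ [ isRoot x ] * [ isRoot y ] * [ A (root x) (root y) ] + [ ⌊ root x ≟ root y ⌋ ]
    cliqueAdj-indicator x y =
      trans (cong₂ (λ x′ y′ → [ H x′ y′ ] + [ ⌊ x′ ≟ y′ ⌋ ])
                   (sym (combine-remQuot {n} m x)) (sym (combine-remQuot {n} m y)))
            (cliqueAdj-indicator-combine (root x) (layer x) (root y) (layer y))

    block : Subset (n * m) → Fin n → Fin m → Bool
    block S v k = mem S (combine v k)

    blockSize : Subset (n * m) → Fin n → ℕ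
    blockSize S v = ∑[ k < m ] [ block S v k ]

    core : Subset (n * m) → Subset n
    core S = Vec.tabulate (λ v → block S v zero)

    ∣∣-blocks : ∀ S → ∣ S ∣ ≡ ∑[ v < n ] blockSize S v
    ∣∣-blocks S = trans (∣∣≡∑mem S) (∑-combine n m (λ x → [ mem S x ]))

    ∣core∣ : ∀ S → ∣ core S ∣ ≡ ∑[ v < n ] [ block S v zero ]
    ∣core∣ S =
      trans (∣∣≡∑mem (core S)) (sum-cong-≗ (λ v → cong [_] (mem-tabulate (λ v → block S v zero) v)))

    edgesIn-blocks : ∀ S →
      2 * edgesIn H S + ∣ S ∣ ≡ 2 * edgesIn A (core S) + ∑[ v < n ] (blockSize S v * blockSize S v)
    edgesIn-blocks S = begin
      2 * edgesIn H S + ∣ S ∣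
        ≡⟨ cong₂ _+_ (edgesIn-double cliqueGraph S) (trans (∣∣≡∑mem S) (sym diagonal)) ⟩
      quadForm σ (λ x y → [ H x y ]) + quadForm σ (λ x y → [ ⌊ x ≟ y ⌋ ])
        ≡⟨ quadForm-+ σ (λ x y → [ H x y ]) (λ x y → [ ⌊ x ≟ y ⌋ ]) ⟨
      quadForm σ (λ x y → [ H x y ] + [ ⌊ x ≟ y ⌋ ])
        ≡⟨ quadForm-congʳ σ cliqueAdj-indicator ⟩
      quadForm σ (λ x y → rootAdj x y + sameRoot x y)
        ≡⟨ quadForm-+ σ rootAdj sameRoot ⟩
      quadForm σ rootAdj + quadForm σ sameRoot
        ≡⟨ cong₂ _+_ roots cliques ⟩
      2 * edgesIn A (core S) + ∑[ v < n ] (blockSize S v * blockSize S v) ∎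
      where
      open ≡-Reasoning
      σ : Fin (n * m) → ℕ
      σ x = [ mem S x ]
      rootAdj sameRoot : Fin (n * m) → Fin (n * m) → ℕ
      rootAdj x y = [ isRoot x ] * [ isRoot y ] * [ A (root x) (root y) ]
      sameRoot x y = [ ⌊ root x ≟ root y ⌋ ]
      diagonal : quadForm σ (λ x y → [ ⌊ x ≟ y ⌋ ]) ≡ ∑[ x < n * m ] σ x
      diagonal = trans (quadForm-δ σ) (sum-cong-≗ ([]-idem ∘ mem S))
      coreWeight : ∀ v → ∑[ k < m ] (σ (combine v k) * [ isRoot (combine v k) ]) ≡ [ mem (core S) v ]
      coreWeight v = begin
        ∑[ k < m ] (σ (combine v k) * [ isRoot (combine v k) ])
          ≡⟨ sum-cong-≗ (λ k → trans (cong (λ p → σ (combine v k) * [ ⌊ zero ≟ proj₂ p ⌋ ]) (remQuot-combine v k))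
                                     (*-comm (σ (combine v k)) _)) ⟩
        ∑[ k < m ] ([ ⌊ zero ≟ k ⌋ ] * [ block S v k ])
          ≡⟨ ∑-δ (λ k → [ block S v k ]) zero ⟩
        [ block S v zero ]
          ≡⟨ cong [_] (mem-tabulate (λ v → block S v zero) v) ⟨
        [ mem (core S) v ] ∎
      roots : quadForm σ rootAdj ≡ 2 * edgesIn A (core S)
      roots = begin
        quadForm σ rootAdj
          ≡⟨ quadForm-rescale σ ([_] ∘ isRoot) (λ x y → [ A (root x) (root y) ]) ⟩
        quadForm (λ x → σ x * [ isRoot x ]) (λ x y → [ A (root x) (root y) ])
          ≡⟨ quadForm-remQuot n m (λ x → σ x * [ isRoot x ]) (λ v w → [ A v w ]) ⟩
        quadForm (λ v → ∑[ k < m ] (σ (combine v k) * [ isRoot (combine v k) ])) (λ v w → [ A v w ])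
          ≡⟨ quadForm-congˡ coreWeight (λ v w → [ A v w ]) ⟩
        quadForm (λ v → [ mem (core S) v ]) (λ v w → [ A v w ])
          ≡⟨ edgesIn-double G (core S) ⟨
        2 * edgesIn A (core S) ∎
      cliques : quadForm σ sameRoot ≡ ∑[ v < n ] (blockSize S v * blockSize S v)
      cliques = trans (quadForm-remQuot n m σ (λ v w → [ ⌊ v ≟ w ⌋ ])) (quadForm-δ (blockSize S))

    cliqueContributions-≤ : ∀ {D M} → D ≤ M → ∀ S →
      m * (D * ∣ core S ∣) + M * ∑[ v < n ] (blockSize S v * blockSize S v) ≤ (D + m * M) * ∣ S ∣
    cliqueContributions-≤ {D} {M} D≤M S = begin
      m * (D * ∣ core S ∣) + M * ∑[ v < n ] (a v * a v)
        ≡⟨ cong (λ t → m * (D * t) + M * ∑[ v < n ] (a v * a v)) (∣core∣ S) ⟩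
      m * (D * ∑[ v < n ] t v) + M * ∑[ v < n ] (a v * a v)
        ≡⟨ cong₂ _+_ (trans (cong (m *_) (*-distribˡ-sum D t)) (*-distribˡ-sum m (λ v → D * t v)))
                     (*-distribˡ-sum M (λ v → a v * a v)) ⟩
      ∑[ v < n ] (m * (D * t v)) + ∑[ v < n ] (M * (a v * a v))
        ≡⟨ ∑-distrib-+ (λ v → m * (D * t v)) (λ v → M * (a v * a v)) ⟨
      ∑[ v < n ] (m * (D * t v) + M * (a v * a v))
        ≤⟨ ∑-mono-≤ (λ v → cliqueContribution-≤ (block S v zero) (∑-[]-≤ (λ k → block S v (suc k))) D≤M) ⟩
      ∑[ v < n ] ((D + m * M) * a v)
        ≡⟨ *-distribˡ-sum (D + m * M) a ⟨
      (D + m * M) * ∑[ v < n ] a v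
        ≡⟨ cong ((D + m * M) *_) (∣∣-blocks S) ⟨
      (D + m * M) * ∣ S ∣ ∎
      where
      open ≤-Reasoning
      a t : Fin n → ℕ
      a = blockSize S
      t v = [ block S v zero ]

    edgesIn-cliqueAdj-≤ : ∀ {E V} → 2 * E ≤ m * V → (∀ T → edgesIn A T * V ≤ E * ∣ T ∣) →
      ∀ S → edgesIn H S * (m * V) ≤ (E + C * (m * V)) * ∣ S ∣
    edgesIn-cliqueAdj-≤ {E} {V} 2E≤mV edgesIn-≤-E S =
      *-cancelˡ-≤ 2 (+-cancelʳ-≤ (∣ S ∣ * M) (2 * (edgesIn H S * M)) (2 * ((E + C * M) * ∣ S ∣)) doubled)
      where
      open ≤-Reasoning
      open +-*-Solver
      M : ℕ
      M = m * V
      Q : ℕ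
      Q = ∑[ v < n ] (blockSize S v * blockSize S v)
      doubled : 2 * (edgesIn H S * M) + ∣ S ∣ * M ≤ 2 * ((E + C * M) * ∣ S ∣) + ∣ S ∣ * M
      doubled = begin
        2 * (edgesIn H S * M) + ∣ S ∣ * M
          ≡⟨ solve 3 (λ e s M → con 2 :* (e :* M) :+ s :* M := (con 2 :* e :+ s) :* M)
                     refl (edgesIn H S) ∣ S ∣ M ⟩
        (2 * edgesIn H S + ∣ S ∣) * M
          ≡⟨ cong (_* M) (edgesIn-blocks S) ⟩
        (2 * edgesIn A (core S) + Q) * M
          ≡⟨ solve 4 (λ e q c V → (con 2 :* e :+ q) :* ((con 1 :+ con 2 :* c) :* V)
                                 := (con 1 :+ con 2 :* c) :* (con 2 :* (e :* V)) :+ (con 1 :+ con 2 :* c) :* V :* q)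
                   refl (edgesIn A (core S)) Q C V ⟩
        m * (2 * (edgesIn A (core S) * V)) + M * Q
          ≤⟨ +-monoˡ-≤ (M * Q) (*-monoʳ-≤ m (*-monoʳ-≤ 2 (edgesIn-≤-E (core S)))) ⟩
        m * (2 * (E * ∣ core S ∣)) + M * Q
          ≡⟨ cong (λ z → m * z + M * Q) (*-assoc 2 E ∣ core S ∣) ⟨
        m * (2 * E * ∣ core S ∣) + M * Q
          ≤⟨ cliqueContributions-≤ 2E≤mV S ⟩
        (2 * E + m * M) * ∣ S ∣
          ≡⟨ solve 4 (λ E c V s → (con 2 :* E :+ (con 1 :+ con 2 :* c) :* ((con 1 :+ con 2 :* c) :* V)) :* s
                                 := con 2 :* ((E :+ c :* ((con 1 :+ con 2 :* c) :* V)) :* s) :+ s :* ((con 1 :+ con 2 :* c) :* V))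
                   refl E C V ∣ S ∣ ⟩
        2 * ((E + C * M) * ∣ S ∣) + ∣ S ∣ * M ∎

    blowUp : Subset n → Subset (n * m)
    blowUp S = Vec.tabulate (λ x → mem S (root x))

    block-blowUp : ∀ S v k → block (blowUp S) v k ≡ mem S v
    block-blowUp S v k =
      trans (mem-tabulate (λ x → mem S (root x)) (combine v k)) (cong (λ p → mem S (proj₁ p)) (remQuot-combine v k))

    blockSize-blowUp : ∀ S v → blockSize (blowUp S) v ≡ m * [ mem S v ]
    blockSize-blowUp S v = trans (sum-cong-≗ (λ k → cong [_] (block-blowUp S v k))) (∑-const m [ mem S v ])

    core-blowUp : ∀ S → core (blowUp S) ≡ S
    core-blowUp S = trans (tabulate-cong (λ v → block-blowUp S v zero)) (tabulate-mem S)

    ∣blowUp∣ : ∀ S → ∣ blowUp S ∣ ≡ m * ∣ S ∣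
    ∣blowUp∣ S = begin
      ∣ blowUp S ∣                    ≡⟨ ∣∣-blocks (blowUp S) ⟩
      ∑[ v < n ] blockSize (blowUp S) v ≡⟨ sum-cong-≗ (blockSize-blowUp S) ⟩
      ∑[ v < n ] (m * [ mem S v ])      ≡⟨ *-distribˡ-sum m (λ v → [ mem S v ]) ⟨
      m * ∑[ v < n ] [ mem S v ]        ≡⟨ cong (m *_) (∣∣≡∑mem S) ⟨
      m * ∣ S ∣                       ∎
      where open ≡-Reasoning

    edgesIn-blowUp : ∀ S → edgesIn H (blowUp S) ≡ edgesIn A S + C * (m * ∣ S ∣)
    edgesIn-blowUp S = *-cancelˡ-≡ _ _ 2 (+-cancelʳ-≡ (m * ∣ S ∣) _ _ (begin
      2 * edgesIn H Ŝ + m * ∣ S ∣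
        ≡⟨ cong (2 * edgesIn H Ŝ +_) (∣blowUp∣ S) ⟨
      2 * edgesIn H Ŝ + ∣ Ŝ ∣
        ≡⟨ edgesIn-blocks Ŝ ⟩
      2 * edgesIn A (core Ŝ) + ∑[ v < n ] (blockSize Ŝ v * blockSize Ŝ v)
        ≡⟨ cong₂ _+_ (cong (λ T → 2 * edgesIn A T) (core-blowUp S)) squares ⟩
      2 * edgesIn A S + m * m * ∣ S ∣
        ≡⟨ solve 3 (λ e c s → con 2 :* e :+ (con 1 :+ con 2 :* c) :* (con 1 :+ con 2 :* c) :* s
                             := con 2 :* (e :+ c :* ((con 1 :+ con 2 :* c) :* s)) :+ (con 1 :+ con 2 :* c) :* s)
                 refl (edgesIn A S) C ∣ S ∣ ⟩
      2 * (edgesIn A S + C * (m * ∣ S ∣)) + m * ∣ S ∣ ∎))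
      where
      open ≡-Reasoning
      open +-*-Solver
      Ŝ : Subset (n * m)
      Ŝ = blowUp S
      square : ∀ v → m * [ mem S v ] * (m * [ mem S v ]) ≡ m * m * [ mem S v ]
      square v = trans (solve 2 (λ m t → m :* t :* (m :* t) := m :* m :* (t :* t)) refl m [ mem S v ])
                       (cong (m * m *_) ([]-idem (mem S v)))
      squares : ∑[ v < n ] (blockSize Ŝ v * blockSize Ŝ v) ≡ m * m * ∣ S ∣
      squares = begin
        ∑[ v < n ] (blockSize Ŝ v * blockSize Ŝ v)
          ≡⟨ sum-cong-≗ (λ v → trans (cong₂ _*_ (blockSize-blowUp S v) (blockSize-blowUp S v)) (square v)) ⟩
        ∑[ v < n ] (m * m * [ mem S v ])
          ≡⟨ *-distribˡ-sum (m * m) (λ v → [ mem S v ]) ⟨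
        m * m * ∑[ v < n ] [ mem S v ]
          ≡⟨ cong (m * m *_) (∣∣≡∑mem S) ⟨
        m * m * ∣ S ∣ ∎

    maxDensity-cliqueAdj : ∀ S₀ {k₀} → ∣ S₀ ∣ ≡ suc k₀ → maxDensity A ≡ ratio (edgesIn A S₀) k₀ →
      2 * edgesIn A S₀ ≤ m * suc k₀ →
      maxDensity H ≡ ratio (edgesIn A S₀ + C * (m * suc k₀)) (pred (m * suc k₀))
    maxDensity-cliqueAdj S₀ {k₀} ∣S₀∣≡1+k₀ max≡ 2E≤mV =
      maxDensity-unique H (blowUp S₀) (trans (∣blowUp∣ S₀) (cong (m *_) ∣S₀∣≡1+k₀)) ρŜ₀≡ upper
      where
      E X k′ : ℕ
      E = edgesIn A S₀
      X = E + C * (m * suc k₀)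
      k′ = pred (m * suc k₀)
      ρŜ₀≡ : ratio (edgesIn H (blowUp S₀)) k′ ≡ ratio X k′
      ρŜ₀≡ = cong (λ e → ratio e k′)
                  (trans (edgesIn-blowUp S₀) (cong (λ s → E + C * (m * s)) ∣S₀∣≡1+k₀))
      upper : ∀ T j → ∣ T ∣ ≡ suc j → ratio (edgesIn H T) j ℚ.≤ ratio X k′
      upper T j ∣T∣≡1+j = ratio-≤⁺ (edgesIn H T) j X k′
        (subst (λ t → edgesIn H T * (m * suc k₀) ≤ X * t) ∣T∣≡1+j
               (edgesIn-cliqueAdj-≤ {E} 2E≤mV (edgesIn-≤-maxDensity G {E} max≡) T))

open import Defs
open import Data.Nat using (ℕ; suc; _≤_) renaming (_*_ to _*ℕ_; _+_ to _+ℕ_)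
open import Data.Integer using (+_)
open import Data.Rational using (ℚ; _+_; _*_; _<_; _/_)
open import Relation.Binary.PropositionalEquality using (_≡_)

open import Data.Fin using (zero)
open import Data.Nat using (pred)
open import Data.Fin.Subset using (⁅_⁆)
open import Data.Fin.Subset.Properties using (∣⁅x⁆∣≡1)
open import Data.Nat.Properties using (*-comm; +-comm)
open import Data.Product using (_,_)
open import Data.Rational.Properties using (<⇒≤)
open import Relation.Binary.PropositionalEquality using (cong; subst; subst₂; module ≡-Reasoning)
open CliqueBlowUpDensity

-- The argument never uses 1 ≤ C (for C = 0 the statement reads ρ(G) = ρ(G)).
proposition6 : (C : ℕ) → 1 ≤ C → (n : ℕ) → 1 ≤ n → (G : Graph n) →
    maxDensity (adj G) < (+ (2 *ℕ C +ℕ 1)) / 2 →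
    maxDensity (cliqueAdj C G) ≡ maxDensity (adj G) * ((+ 1) / suc (2 *ℕ C)) + (+ C) / 1
proposition6 C _ (suc n) _ G ρ<m/2 =
  let S₀ , k₀ , ∣S₀∣≡1+k₀ , ρ≡ = maxDensity-attained (adj G) ⁅ zero ⁆ (∣⁅x⁆∣≡1 {suc n} zero)
      E₀ = edgesIn (adj G) S₀
      2E₀≤mV₀ = subst₂ _≤_ (*-comm E₀ 2) (cong (_*ℕ suc k₀) (+-comm (2 *ℕ C) 1))
                  (ratio-≤⁻ E₀ k₀ (2 *ℕ C +ℕ 1) 1 (<⇒≤ (subst (_< ratio (2 *ℕ C +ℕ 1) 1) ρ≡ ρ<m/2)))
  in begin
  maxDensity (cliqueAdj C G)
    ≡⟨ CliqueBlowUp.maxDensity-cliqueAdj C G S₀ ∣S₀∣≡1+k₀ ρ≡ 2E₀≤mV₀ ⟩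
  ratio (E₀ +ℕ C *ℕ (suc (2 *ℕ C) *ℕ suc k₀)) (pred (suc (2 *ℕ C) *ℕ suc k₀))
    ≡⟨ ratio-affine E₀ k₀ C (2 *ℕ C) ⟨
  ratio E₀ k₀ * ratio 1 (2 *ℕ C) + ratio C 0
    ≡⟨ cong (λ ρ → ρ * ratio 1 (2 *ℕ C) + ratio C 0) ρ≡ ⟨
  maxDensity (adj G) * ((+ 1) / suc (2 *ℕ C)) + (+ C) / 1 ∎
  where open ≡-Reasoning
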